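{- Let $\pi$ be a set partition of $\{1,\dots,n\}$ and let $\phi(\pi)=(\lambda_0,\dots,\lambda_{2n})$. For every $i\in\{1,\dots,n\}$ and every $k\ge 1$, the segment $[i,i+1]$ of $\pi$ is below a $k$-crossing if and only if $\lambda_{2i}$ has at least $k$ rows, and the segment $[i,i+1]$ is below a $k$-nesting if and only if $\lambda_{2i}$ has at least $k$ columns.
   Context: A set partition $\pi$ of $\{1,\dots,n\}$ is represented by its arcs: each block $\{a_1<a_2<\dots<a_j\}$ contributes the arcs $(a_1,a_2),(a_2,a_3),\dots,(a_{j-1},a_j)$ (singleton blocks contribute no arc). The segment $[i,i+1]$ is below a $k$-crossing if there are $k$ arcs $(i_1,j_1),\dots,(i_k,j_k)$ of $\pi$ with $i_1<\dots<i_k\le i$ and $i+1\le j_1<j_2<\dots<j_k$; it is below a $k$-nesting if there are $k$ arcs with $i_1<\dots<i_k\le i$ and $i+1\le j_k<\dots<j_2<j_1$. The map $\phi$: build a sequence of fillings $T_0,\dots,T_{2n}$ of Ferrers diagrams by positive integers, strictly decreasing along rows and down columns. Set $T_0=\varnothing$. For $i=1,\dots,n$: if $i$ is the right endpoint of an arc, $T_{2i-1}$ is $T_{2i-2}$ with the entry $i$ deleted (it is always in a corner), otherwise $T_{2i-1}=T_{2i-2}$; then if $i$ is the left endpoint of an arc $(i,j)$, $T_{2i}$ is obtained by inserting $j$ into $T_{2i-1}$ by Robinson–Schensted row insertion for the decreasing order (in the current row, $j$ replaces the leftmost entry smaller than $j$, which is bumped into the next row; if no entry is smaller than $j$, $j$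 is appended at the end of the row), otherwise $T_{2i}=T_{2i-1}$. Then $\phi(\pi)=(\lambda_0,\dots,\lambda_{2n})$ where $\lambda_r$ is the shape of $T_r$. -}

module Defs where

open import Data.Nat using (ℕ; zero; suc; _+_; _*_; _≤_; _<_; _<ᵇ_; _≡ᵇ_; _≟_)
open import Data.Nat.DivMod using (_/_; _%_)
open import Data.Bool using (Bool; true; false; _∧_; if_then_else_)
open import Data.List using (List; []; _∷_; map; filter; filterᵇ; length; upTo)
open import Data.Bool.ListAction using (any)
open import Data.Maybe using (Maybe; just; nothing)
open import Data.Product using (Σ; _×_; _,_; ∃)
open import Data.Fin using (Fin) renaming (_<_ to _<ᶠ_)
open import Relation.Nullary using (¬_; ¬?)
open import Relation.Binary.PropositionalEquality using (_≡_; _≢_)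

-- Set partitions of {1,…,n}, given by a block labelling:
-- elements x, y ∈ {1,…,n} lie in the same block iff block x ≡ block y.
-- (Values of 'block' outside {1,…,n} are irrelevant.)

record SetPartition (n : ℕ) : Set where
  constructor mkPartition
  field
    block : ℕ → ℕ

open SetPartition public

Arc : {n : ℕ} → SetPartition n → ℕ → ℕ → Set
Arc {n} π a b =
  1 ≤ a × a < b × b ≤ n × block π a ≡ block π b ×
  (∀ c → a < c → c < b → block π c ≢ block π a)

BelowCrossing : {n : ℕ} → SetPartition n → ℕ → ℕ → Set
BelowCrossing π i k =
  Σ (Fin k → ℕ) λ I → Σ (Fin k → ℕ) λ J →
    (∀ a → Arc π (I a) (J a)) ×
    (∀ a → I a ≤ i × suc i ≤ J a) ×
    (∀ a b → a <ᶠ b → I a < I b × J a < J b)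

BelowNesting : {n : ℕ} → SetPartition n → ℕ → ℕ → Set
BelowNesting π i k =
  Σ (Fin k → ℕ) λ I → Σ (Fin k → ℕ) λ J →
    (∀ a → Arc π (I a) (J a)) ×
    (∀ a → I a ≤ i × suc i ≤ J a) ×
    (∀ a b → a <ᶠ b → I a < I b × J b < J a)

-- Fillings (tableaux) as lists of rows, top row first.

Tableau : Set
Tableau = List (List ℕ)

-- Row insertion for the decreasing order: j replaces the leftmost entry
-- smaller than j (which is returned as bumped), else j is appended.
insertRow : ℕ → List ℕ → Maybe ℕ × List ℕ
insertRow j [] = nothing , j ∷ []
insertRow j (x ∷ xs) with x <ᵇ j
... | true = just x , j ∷ xs
... | false with insertRow j xs
...   | (b , ys) = b , x ∷ ys

rsInsert : ℕ → Tableau → Tableau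
rsInsert j [] = (j ∷ []) ∷ []
rsInsert j (r ∷ rs) with insertRow j r
... | (nothing , r') = r' ∷ rs
... | (just y , r') = r' ∷ rsInsert y rs

nonEmpty : List ℕ → Bool
nonEmpty [] = false
nonEmpty (_ ∷ _) = true

deleteEntry : ℕ → Tableau → Tableau
deleteEntry i T = filterᵇ nonEmpty (map (filter (λ x → ¬? (x ≟ i))) T)

above : ℕ → ℕ → List ℕ
above n i = filterᵇ (λ j → i <ᵇ j) (upTo (suc n))

isRightEnd : {n : ℕ} → SetPartition n → ℕ → Bool
isRightEnd π i = any (λ a → (0 <ᵇ a) ∧ (block π a ≡ᵇ block π i)) (upTo i)

firstOf : List ℕ → Maybe ℕ
firstOf [] = nothing
firstOf (x ∷ _) = just x

arcFrom : {n : ℕ} → SetPartition n → ℕ → Maybe ℕ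
arcFrom {n} π i = firstOf (filterᵇ (λ j → block π j ≡ᵇ block π i) (above n i))

stepDelete : {n : ℕ} → SetPartition n → ℕ → Tableau → Tableau
stepDelete π i T = if isRightEnd π i then deleteEntry i T else T

stepInsert : {n : ℕ} → SetPartition n → ℕ → Tableau → Tableau
stepInsert π i T with arcFrom π i
... | nothing = T
... | just j = rsInsert j T

tabEven : {n : ℕ} → SetPartition n → ℕ → Tableau
tabEven π zero = []
tabEven π (suc i) = stepInsert π (suc i) (stepDelete π (suc i) (tabEven π i))

tabOdd : {n : ℕ} → SetPartition n → ℕ → Tableau
tabOdd π i = stepDelete π (suc i) (tabEven π i)

tab : {n : ℕ} → SetPartition n → ℕ → Tableau
tab π r with r % 2
... | zero = tabEven π (r / 2)
... | suc _ = tabOdd π (r / 2)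

Shape : Set
Shape = List ℕ

shape : Tableau → Shape
shape = map length

numRows : Shape → ℕ
numRows = length

numCols : Shape → ℕ
numCols [] = 0
numCols (r ∷ _) = r

-- φ(π) = (λ_0, …, λ_{2n}); phi π r = λ_r  (meaningful for r ≤ 2n)
phi : {n : ℕ} → SetPartition n → ℕ → Shape
phi π r = shape (tab π r)

module Submission where

-- Let w_i be the word of right endpoints of the arcs open over [i,i+1], listed by left endpoint.
-- A k-crossing (k-nesting) over the segment is exactly an increasing (decreasing) subsequence of
-- length k of w_i. Deleting the smallest entry and Robinson–Schensted insertion keep the reading
-- word of T_{2i} Knuth equivalent to w_i; Knuth moves preserve the existence of increasing and
-- decreasing subsequences of each length; and in a tableau with decreasing rows and columns the
-- longest increasing (decreasing) subsequence of the reading word is as long as the first column (row).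

open import Defs
open import Data.Bool using (Bool; true; false; T; T?)
open import Data.Empty using (⊥; ⊥-elim)
open import Data.Fin using (Fin; inject≤) renaming (_<_ to _<ᶠ_; zero to fzero; suc to fsuc)
open import Data.Fin.Properties using (toℕ-inject≤)
open import Data.List using (List; []; _∷_; _++_; length; map; filter; filterᵇ; lookup; tabulate)
open import Data.List.Membership.Propositional using (_∈_; lose)
open import Data.List.Membership.Propositional.Properties
  using (∈-filter⁻; ∈-filter⁺; ∈-upTo⁺; ∈-upTo⁻; ∈-++⁺ˡ; ∈-++⁺ʳ; ∈-lookup)
open import Data.List.Properties
  using (++-assoc; ++-identityʳ; length-++; length-map; length-tabulate; map-++; filter-++; filter-accept; filter-reject)
open import Data.List.Relation.Binary.Permutation.Propositional using (_↭_; prep; swap; ↭-refl; ↭-sym; ↭-isEquivalence; ↭⇒↭ₛ)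
import Data.List.Relation.Binary.Permutation.Propositional.Properties as Perm
open import Data.List.Relation.Binary.Prefix.Heterogeneous using (Prefix; []; _∷_)
import Data.List.Relation.Binary.Prefix.Heterogeneous.Properties as Prefix
open import Data.List.Relation.Binary.Sublist.Propositional using (_⊆_; []; _∷_; _∷ʳ_; ⊆-refl; minimum)
open import Data.List.Relation.Binary.Sublist.Propositional.Properties using (All-resp-⊆)
import Data.List.Relation.Binary.Sublist.Propositional.Properties as Sublist
open import Data.List.Relation.Unary.All using (All; []; _∷_)
  renaming (map to All-map; lookup to All-lookup; zipWith to All-zipWith)
import Data.List.Relation.Unary.All.Properties as All
open import Data.List.Relation.Unary.AllPairs using (AllPairs; []; _∷_)
import Data.List.Relation.Unary.AllPairs.Properties as AllPairs
open import Data.List.Relation.Unary.Any using (here; there)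
import Data.List.Relation.Unary.Any.Properties as Any
open import Data.List.Relation.Unary.Unique.Propositional using (Unique)
open import Data.Maybe using (Maybe; just; nothing)
open import Data.Nat using (ℕ; zero; suc; _*_; _≤_; _<_; _>_; z≤n; s≤s; _≟_; _<ᵇ_; _≡ᵇ_)
open import Data.Nat.DivMod using (_/_; _%_; m*n%n≡0; m*n/n≡m)
open import Data.Nat.Properties
  using ( ≤-refl; ≤-trans; ≤-pred; <-trans; <-irrefl; <-asym; <⇒≤; <-≤-trans; ≤-<-trans; m≤n⇒m≤1+n
        ; ≤∧≢⇒<; ≮⇒≥; >⇒≢; +-comm; +-mono-≤; *-comm; <ᵇ⇒<; <⇒<ᵇ; <ᵇ-reflects-<; ≡ᵇ⇒≡; ≡⇒≡ᵇ)
open import Data.Product using (Σ; ∃; ∃₂; _×_; _,_; proj₁; proj₂)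
open import Data.Unit using (⊤; tt)
open import Function using (id; _∘_; _on_)
open import Function.Bundles using (_⇔_; mk⇔)
open import Function.Properties.Equivalence using (⇔-isEquivalence; ⇔-setoid)
open import Level using (0ℓ)
open import Relation.Binary.Construct.Closure.Equivalence using (EqClosure)
import Relation.Binary.Construct.Closure.Equivalence as EqClosure
open import Relation.Binary.Construct.Closure.ReflexiveTransitive using (ε; _◅_)
open import Relation.Binary.Construct.Closure.Symmetric using (fwd; bwd)
open import Relation.Binary.PropositionalEquality
  using (_≡_; _≢_; refl; sym; trans; cong; subst; subst₂) renaming (setoid to ≡-setoid)
open import Data.List.Relation.Binary.Permutation.Setoid.Properties (≡-setoid ℕ) using (Unique-resp-↭)
import Relation.Binary.Reasoning.Setoid as EqReasoning
open import Relation.Nullary using (¬_; ¬?; yes; no; Dec)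
open import Relation.Nullary.Reflects using (ofʸ; ofⁿ)

≤∧≢ʳ⇒< : ∀ {a b : ℕ} → a ≤ b → b ≢ a → a < b
≤∧≢ʳ⇒< a≤b b≢a = ≤∧≢⇒< a≤b (λ a≡b → b≢a (sym a≡b))

-- Sublists and chains

module _ {A : Set} where

  ⊆-++-split : (xs ys : List A) {t : List A} → t ⊆ xs ++ ys →
    ∃₂ λ t₁ t₂ → t ≡ t₁ ++ t₂ × t₁ ⊆ xs × t₂ ⊆ ys
  ⊆-++-split [] ys τ = [] , _ , refl , [] , τ
  ⊆-++-split (x ∷ xs) ys (.x ∷ʳ τ) with ⊆-++-split xs ys τ
  ... | t₁ , t₂ , refl , τ₁ , τ₂ = t₁ , t₂ , refl , x ∷ʳ τ₁ , τ₂
  ⊆-++-split (x ∷ xs) ys (refl ∷ τ) with ⊆-++-split xs ys τ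
  ... | t₁ , t₂ , refl , τ₁ , τ₂ = x ∷ t₁ , t₂ , refl , refl ∷ τ₁ , τ₂

  AllPairs-resp-⊆ : {R : A → A → Set} {t xs : List A} → t ⊆ xs → AllPairs R xs → AllPairs R t
  AllPairs-resp-⊆ [] [] = []
  AllPairs-resp-⊆ (_ ∷ʳ τ) (_ ∷ rs) = AllPairs-resp-⊆ τ rs
  AllPairs-resp-⊆ (refl ∷ τ) (rx ∷ rs) = All-resp-⊆ τ rx ∷ AllPairs-resp-⊆ τ rs

  AllPairs-++⁻ : {R : A → A → Set} (xs : List A) {ys : List A} → AllPairs R (xs ++ ys) →
    AllPairs R xs × AllPairs R ys × All (λ x → All (R x) ys) xs
  AllPairs-++⁻ [] rs = [] , rs , []
  AllPairs-++⁻ (x ∷ xs) (rx ∷ rs) with AllPairs-++⁻ xs rs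
  ... | rxs , rys , rxys = All.++⁻ˡ xs rx ∷ rxs , rys , All.++⁻ʳ xs rx ∷ rxys

  AllPairs-replace : {R : A → A → Set} (xs : List A) {m m′ ys : List A} →
    AllPairs R (xs ++ m ++ ys) → AllPairs R m′ →
    (∀ e → All (R e) m → All (R e) m′) →
    (∀ zs → All (λ a → All (R a) zs) m → All (λ a → All (R a) zs) m′) →
    AllPairs R (xs ++ m′ ++ ys)
  AllPairs-replace [] {m} {m′} {ys} rs rm′ lower upper with AllPairs-++⁻ m rs
  ... | _ , rys , rmys = AllPairs.++⁺ rm′ rys (upper ys rmys)
  AllPairs-replace {R} (x ∷ xs) {m} {m′} {ys} (rx ∷ rs) rm′ lower upper =
    All.++⁺ (All.++⁻ˡ xs rx) (All.++⁺ (lower x (All.++⁻ˡ m rest)) (All.++⁻ʳ m rest))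
    ∷ AllPairs-replace xs rs rm′ lower upper
    where
    rest : All (R x) (m ++ ys)
    rest = All.++⁻ʳ xs rx

  AllPairs-mapWithAll : {R S : A → A → Set} {P : A → Set} {xs : List A} →
    (∀ {x y} → P x → P y → R x y → S x y) → All P xs → AllPairs R xs → AllPairs S xs
  AllPairs-mapWithAll f [] [] = []
  AllPairs-mapWithAll f (px ∷ ps) (rx ∷ rs) =
    All-zipWith (λ (py , r) → f px py r) (ps , rx) ∷ AllPairs-mapWithAll f ps rs

  AllPairs-lookup : {R : A → A → Set} {xs : List A} → AllPairs R xs →
    ∀ {i j : Fin (length xs)} → i <ᶠ j → R (lookup xs i) (lookup xs j)
  AllPairs-lookup (rx ∷ _) {fzero} {fsuc j} _ = All-lookup rx (∈-lookup j)
  AllPairs-lookup (_ ∷ rs) {fsuc i} {fsuc j} (s≤s i<j) = AllPairs-lookup rs i<j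

  ⊆-map-preimage : {B : Set} (f : A → B) (xs : List A) {t : List B} → t ⊆ map f xs →
    ∃ λ ys → ys ⊆ xs × map f ys ≡ t
  ⊆-map-preimage f [] [] = [] , [] , refl
  ⊆-map-preimage f (x ∷ xs) (_ ∷ʳ τ) with ⊆-map-preimage f xs τ
  ... | ys , σ , eq = ys , x ∷ʳ σ , eq
  ⊆-map-preimage f (x ∷ xs) (refl ∷ τ) with ⊆-map-preimage f xs τ
  ... | ys , σ , eq = x ∷ ys , refl ∷ σ , cong (f x ∷_) eq

  skip-head : (key : A → ℕ) {y e : A} {ys : List A} → e ∈ y ∷ ys → key y < key e → e ∈ ys
  skip-head key (here refl) y<y = ⊥-elim (<-irrefl refl y<y)
  skip-head key (there e∈) _ = e∈

  sorted-⊆ : (key : A → ℕ) {xs ys : List A} → AllPairs (_<_ on key) ys → AllPairs (_<_ on key) xs →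
    All (_∈ ys) xs → xs ⊆ ys
  sorted-⊆ key {[]} {ys} _ _ _ = minimum ys
  sorted-⊆ key {x ∷ xs} {y ∷ ys} (y<ys ∷ sorted-ys) (x<xs ∷ sorted-xs) (here refl ∷ xs∈) =
    refl ∷ sorted-⊆ key sorted-ys sorted-xs (All-zipWith (λ (e∈ , x<e) → skip-head key e∈ x<e) (xs∈ , x<xs))
  sorted-⊆ key {x ∷ xs} {y ∷ ys} (y<ys ∷ sorted-ys) (x<xs ∷ sorted-xs) (there x∈ ∷ xs∈) =
    y ∷ʳ sorted-⊆ key sorted-ys (x<xs ∷ sorted-xs)
      (x∈ ∷ All-zipWith (λ (e∈ , x<e) → skip-head key e∈ (<-trans (All-lookup y<ys x∈) x<e)) (xs∈ , x<xs))

  HasChain : (A → A → Set) → ℕ → List A → Set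
  HasChain R k w = ∃ λ t → t ⊆ w × AllPairs R t × k ≤ length t

-- Knuth equivalence

module ChainTransfer {A : Set} (R : A → A → Set)
  (R-trans : ∀ {a b c} → R a b → R b c → R a c)
  (R-asym : ∀ {a b} → R a b → R b a → ⊥) where

  -- m′ can take the place of the chain m inside any longer chain.
  record _Replaces_ (m′ m : List A) : Set where
    constructor replaces
    field
      length-≡ : length m ≡ length m′
      keeps-lower : ∀ e → All (R e) m → All (R e) m′
      keeps-upper : ∀ zs → All (λ a → All (R a) zs) m → All (λ a → All (R a) zs) m′

  ChainsTransfer : List A → List A → Set
  ChainsTransfer u v = ∀ {m} → m ⊆ u → AllPairs R m →
    ∃ λ m′ → m′ ⊆ v × AllPairs R m′ × m′ Replaces m

  transfer : ∀ {u v} → ChainsTransfer u v → ∀ {k} p s →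
    HasChain R k (p ++ u ++ s) → HasChain R k (p ++ v ++ s)
  transfer {u} {v} tr p s (t , τ , chain , k≤) with ⊆-++-split p (u ++ s) τ
  ... | t₁ , t′ , refl , τ₁ , τ′ with ⊆-++-split u s τ′
  ... | m , t₂ , refl , τm , τ₂ with tr τm (proj₁ (AllPairs-++⁻ m (proj₁ (proj₂ (AllPairs-++⁻ t₁ chain)))))
  ... | m′ , τm′ , chain′ , replaces len lower upper =
    t₁ ++ m′ ++ t₂ , Sublist.++⁺ τ₁ (Sublist.++⁺ τm′ τ₂) ,
    AllPairs-replace t₁ chain chain′ lower upper ,
    subst (_ ≤_) (length-middle t₁ t₂ len) k≤
    where
    length-middle : ∀ a d {b c : List A} → length b ≡ length c →
      length (a ++ b ++ d) ≡ length (a ++ c ++ d)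
    length-middle a d {b} {c} eq
      rewrite length-++ a {b ++ d} | length-++ a {c ++ d} | length-++ b {d} | length-++ c {d} | eq = refl

  private
    same : ∀ {m v} → m ⊆ v → AllPairs R m → ∃ λ m′ → m′ ⊆ v × AllPairs R m′ × m′ Replaces m
    same {m} τ chain = m , τ , chain , replaces refl (λ _ r → r) (λ _ r → r)

  yzx⇒yxz : ∀ {x y z} → R x y → R y z → ChainsTransfer (y ∷ z ∷ x ∷ []) (y ∷ x ∷ z ∷ [])
  yzx⇒yxz rxy ryz (_ ∷ʳ _ ∷ʳ _ ∷ʳ []) c = same (_ ∷ʳ _ ∷ʳ _ ∷ʳ []) c
  yzx⇒yxz rxy ryz (_ ∷ʳ _ ∷ʳ refl ∷ []) c = same (_ ∷ʳ refl ∷ _ ∷ʳ []) c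
  yzx⇒yxz rxy ryz (_ ∷ʳ refl ∷ _ ∷ʳ []) c = same (_ ∷ʳ _ ∷ʳ refl ∷ []) c
  yzx⇒yxz rxy ryz (_ ∷ʳ refl ∷ refl ∷ []) ((rzx ∷ []) ∷ _) = ⊥-elim (R-asym rzx (R-trans rxy ryz))
  yzx⇒yxz rxy ryz (refl ∷ _ ∷ʳ _ ∷ʳ []) c = same (refl ∷ _ ∷ʳ _ ∷ʳ []) c
  yzx⇒yxz rxy ryz (refl ∷ _ ∷ʳ refl ∷ []) ((ryx ∷ []) ∷ _) = ⊥-elim (R-asym ryx rxy)
  yzx⇒yxz rxy ryz (refl ∷ refl ∷ _ ∷ʳ []) c = same (refl ∷ _ ∷ʳ refl ∷ []) c
  yzx⇒yxz rxy ryz (refl ∷ refl ∷ refl ∷ []) ((_ ∷ ryx ∷ []) ∷ _) = ⊥-elim (R-asym ryx rxy)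

  yxz⇒yzx : ∀ {x y z} → R x y → R y z → ChainsTransfer (y ∷ x ∷ z ∷ []) (y ∷ z ∷ x ∷ [])
  yxz⇒yzx rxy ryz (_ ∷ʳ _ ∷ʳ _ ∷ʳ []) c = same (_ ∷ʳ _ ∷ʳ _ ∷ʳ []) c
  yxz⇒yzx rxy ryz (_ ∷ʳ _ ∷ʳ refl ∷ []) c = same (_ ∷ʳ refl ∷ _ ∷ʳ []) c
  yxz⇒yzx rxy ryz (_ ∷ʳ refl ∷ _ ∷ʳ []) c = same (_ ∷ʳ _ ∷ʳ refl ∷ []) c
  yxz⇒yzx rxy ryz (_ ∷ʳ refl ∷ refl ∷ []) c =
    _ , refl ∷ refl ∷ _ ∷ʳ [] , (ryz ∷ []) ∷ [] ∷ [] ,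
    replaces refl (λ { e (rex ∷ rez ∷ []) → R-trans rex rxy ∷ rez ∷ [] })
                  (λ { zs (_ ∷ rz ∷ []) → All-map (R-trans ryz) rz ∷ rz ∷ [] })
  yxz⇒yzx rxy ryz (refl ∷ _ ∷ʳ _ ∷ʳ []) c = same (refl ∷ _ ∷ʳ _ ∷ʳ []) c
  yxz⇒yzx rxy ryz (refl ∷ _ ∷ʳ refl ∷ []) c = same (refl ∷ refl ∷ _ ∷ʳ []) c
  yxz⇒yzx rxy ryz (refl ∷ refl ∷ _ ∷ʳ []) ((ryx ∷ []) ∷ _) = ⊥-elim (R-asym ryx rxy)
  yxz⇒yzx rxy ryz (refl ∷ refl ∷ refl ∷ []) ((ryx ∷ _ ∷ []) ∷ _) = ⊥-elim (R-asym ryx rxy)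

  xzy⇒zxy : ∀ {x y z} → R x y → R y z → ChainsTransfer (x ∷ z ∷ y ∷ []) (z ∷ x ∷ y ∷ [])
  xzy⇒zxy rxy ryz (_ ∷ʳ _ ∷ʳ _ ∷ʳ []) c = same (_ ∷ʳ _ ∷ʳ _ ∷ʳ []) c
  xzy⇒zxy rxy ryz (_ ∷ʳ _ ∷ʳ refl ∷ []) c = same (_ ∷ʳ _ ∷ʳ refl ∷ []) c
  xzy⇒zxy rxy ryz (_ ∷ʳ refl ∷ _ ∷ʳ []) c = same (refl ∷ _ ∷ʳ _ ∷ʳ []) c
  xzy⇒zxy rxy ryz (_ ∷ʳ refl ∷ refl ∷ []) ((rzy ∷ []) ∷ _) = ⊥-elim (R-asym rzy ryz)
  xzy⇒zxy rxy ryz (refl ∷ _ ∷ʳ _ ∷ʳ []) c = same (_ ∷ʳ refl ∷ _ ∷ʳ []) c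
  xzy⇒zxy rxy ryz (refl ∷ _ ∷ʳ refl ∷ []) c = same (_ ∷ʳ refl ∷ refl ∷ []) c
  xzy⇒zxy rxy ryz (refl ∷ refl ∷ _ ∷ʳ []) c =
    _ , _ ∷ʳ refl ∷ refl ∷ [] , (rxy ∷ []) ∷ [] ∷ [] ,
    replaces refl (λ { e (rex ∷ rez ∷ []) → rex ∷ R-trans rex rxy ∷ [] })
                  (λ { zs (rx ∷ rz ∷ []) → rx ∷ All-map (R-trans ryz) rz ∷ [] })
  xzy⇒zxy rxy ryz (refl ∷ refl ∷ refl ∷ []) (_ ∷ (rzy ∷ []) ∷ _) = ⊥-elim (R-asym rzy ryz)

  zxy⇒xzy : ∀ {x y z} → R x y → R y z → ChainsTransfer (z ∷ x ∷ y ∷ []) (x ∷ z ∷ y ∷ [])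
  zxy⇒xzy rxy ryz (_ ∷ʳ _ ∷ʳ _ ∷ʳ []) c = same (_ ∷ʳ _ ∷ʳ _ ∷ʳ []) c
  zxy⇒xzy rxy ryz (_ ∷ʳ _ ∷ʳ refl ∷ []) c = same (_ ∷ʳ _ ∷ʳ refl ∷ []) c
  zxy⇒xzy rxy ryz (_ ∷ʳ refl ∷ _ ∷ʳ []) c = same (refl ∷ _ ∷ʳ _ ∷ʳ []) c
  zxy⇒xzy rxy ryz (_ ∷ʳ refl ∷ refl ∷ []) c = same (refl ∷ _ ∷ʳ refl ∷ []) c
  zxy⇒xzy rxy ryz (refl ∷ _ ∷ʳ _ ∷ʳ []) c = same (_ ∷ʳ refl ∷ _ ∷ʳ []) c
  zxy⇒xzy rxy ryz (refl ∷ _ ∷ʳ refl ∷ []) ((rzy ∷ []) ∷ _) = ⊥-elim (R-asym rzy ryz)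
  zxy⇒xzy rxy ryz (refl ∷ refl ∷ _ ∷ʳ []) ((rzx ∷ []) ∷ _) = ⊥-elim (R-asym rzx (R-trans rxy ryz))
  zxy⇒xzy rxy ryz (refl ∷ refl ∷ refl ∷ []) ((rzx ∷ _ ∷ []) ∷ _) = ⊥-elim (R-asym rzx (R-trans rxy ryz))

data KnuthStep : List ℕ → List ℕ → Set where
  yzx↦yxz : ∀ {x y z} p s → x < y → y < z → KnuthStep (p ++ y ∷ z ∷ x ∷ s) (p ++ y ∷ x ∷ z ∷ s)
  xzy↦zxy : ∀ {x y z} p s → x < y → y < z → KnuthStep (p ++ x ∷ z ∷ y ∷ s) (p ++ z ∷ x ∷ y ∷ s)

infix 4 _≈ᴷ_
_≈ᴷ_ : List ℕ → List ℕ → Set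
_≈ᴷ_ = EqClosure KnuthStep

≈ᴷ-refl : ∀ {u} → u ≈ᴷ u
≈ᴷ-refl = EqClosure.reflexive KnuthStep

≈ᴷ-reflexive : ∀ {u v} → u ≡ v → u ≈ᴷ v
≈ᴷ-reflexive refl = ≈ᴷ-refl

≈ᴷ-sym : ∀ {u v} → u ≈ᴷ v → v ≈ᴷ u
≈ᴷ-sym = EqClosure.symmetric KnuthStep

≈ᴷ-trans : ∀ {u v w} → u ≈ᴷ v → v ≈ᴷ w → u ≈ᴷ w
≈ᴷ-trans = EqClosure.transitive KnuthStep

module ≈ᴷ-Reasoning = EqReasoning (EqClosure.setoid KnuthStep)

knuthStep-++ˡ : ∀ q {u v} → KnuthStep u v → KnuthStep (q ++ u) (q ++ v)
knuthStep-++ˡ q (yzx↦yxz {x} {y} {z} p s x<y y<z) =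
  subst₂ KnuthStep (++-assoc q p (y ∷ z ∷ x ∷ s)) (++-assoc q p (y ∷ x ∷ z ∷ s)) (yzx↦yxz (q ++ p) s x<y y<z)
knuthStep-++ˡ q (xzy↦zxy {x} {y} {z} p s x<y y<z) =
  subst₂ KnuthStep (++-assoc q p (x ∷ z ∷ y ∷ s)) (++-assoc q p (z ∷ x ∷ y ∷ s)) (xzy↦zxy (q ++ p) s x<y y<z)

knuthStep-++ʳ : ∀ q {u v} → KnuthStep u v → KnuthStep (u ++ q) (v ++ q)
knuthStep-++ʳ q (yzx↦yxz {x} {y} {z} p s x<y y<z) =
  subst₂ KnuthStep (sym (++-assoc p (y ∷ z ∷ x ∷ s) q)) (sym (++-assoc p (y ∷ x ∷ z ∷ s) q)) (yzx↦yxz p (s ++ q) x<y y<z)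
knuthStep-++ʳ q (xzy↦zxy {x} {y} {z} p s x<y y<z) =
  subst₂ KnuthStep (sym (++-assoc p (x ∷ z ∷ y ∷ s) q)) (sym (++-assoc p (z ∷ x ∷ y ∷ s) q)) (xzy↦zxy p (s ++ q) x<y y<z)

≈ᴷ-++ˡ : ∀ q {u v} → u ≈ᴷ v → q ++ u ≈ᴷ q ++ v
≈ᴷ-++ˡ q = EqClosure.gmap (q ++_) (knuthStep-++ˡ q)

≈ᴷ-++ʳ : ∀ q {u v} → u ≈ᴷ v → u ++ q ≈ᴷ v ++ q
≈ᴷ-++ʳ q = EqClosure.gmap (_++ q) (knuthStep-++ʳ q)

knuthStep⇒↭ : ∀ {u v} → KnuthStep u v → u ↭ v
knuthStep⇒↭ (yzx↦yxz {x} {y} {z} p s _ _) = Perm.++⁺ˡ p (prep y (swap z x ↭-refl))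
knuthStep⇒↭ (xzy↦zxy {x} {y} {z} p s _ _) = Perm.++⁺ˡ p (swap x z ↭-refl)

≈ᴷ⇒↭ : ∀ {u v} → u ≈ᴷ v → u ↭ v
≈ᴷ⇒↭ = EqClosure.fold ↭-isEquivalence knuthStep⇒↭

module <-Chains = ChainTransfer _<_ <-trans <-asym
module >-Chains = ChainTransfer _>_ (λ a>b b>c → <-trans b>c a>b) (λ a>b b>a → <-asym a>b b>a)

knuthStep-hasChain< : ∀ {k u v} → KnuthStep u v → HasChain _<_ k u ⇔ HasChain _<_ k v
knuthStep-hasChain< (yzx↦yxz p s x<y y<z) =
  mk⇔ (<-Chains.transfer (<-Chains.yzx⇒yxz x<y y<z) p s) (<-Chains.transfer (<-Chains.yxz⇒yzx x<y y<z) p s)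
knuthStep-hasChain< (xzy↦zxy p s x<y y<z) =
  mk⇔ (<-Chains.transfer (<-Chains.xzy⇒zxy x<y y<z) p s) (<-Chains.transfer (<-Chains.zxy⇒xzy x<y y<z) p s)

knuthStep-hasChain> : ∀ {k u v} → KnuthStep u v → HasChain _>_ k u ⇔ HasChain _>_ k v
knuthStep-hasChain> (yzx↦yxz p s x<y y<z) =
  mk⇔ (>-Chains.transfer (>-Chains.yxz⇒yzx y<z x<y) p s) (>-Chains.transfer (>-Chains.yzx⇒yxz y<z x<y) p s)
knuthStep-hasChain> (xzy↦zxy p s x<y y<z) =
  mk⇔ (>-Chains.transfer (>-Chains.zxy⇒xzy y<z x<y) p s) (>-Chains.transfer (>-Chains.xzy⇒zxy y<z x<y) p s)

≈ᴷ-hasChain< : ∀ {k u v} → u ≈ᴷ v → HasChain _<_ k u ⇔ HasChain _<_ k v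
≈ᴷ-hasChain< {k} = EqClosure.gfold ⇔-isEquivalence (HasChain _<_ k) knuthStep-hasChain<

≈ᴷ-hasChain> : ∀ {k u v} → u ≈ᴷ v → HasChain _>_ k u ⇔ HasChain _>_ k v
≈ᴷ-hasChain> {k} = EqClosure.gfold ⇔-isEquivalence (HasChain _>_ k) knuthStep-hasChain>

erase : ℕ → List ℕ → List ℕ
erase m = filter (λ x → ¬? (x ≟ m))

erase-∷-≢ : ∀ m {a} l → a ≢ m → erase m (a ∷ l) ≡ a ∷ erase m l
erase-∷-≢ m l a≢m = filter-accept (λ x → ¬? (x ≟ m)) a≢m

erase-∷-≡ : ∀ m l → erase m (m ∷ l) ≡ erase m l
erase-∷-≡ m l = filter-reject (λ x → ¬? (x ≟ m)) (λ m≢m → m≢m refl)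

-- If x = m, both sides erase to the same word; otherwise the same move applies after erasing.
erase-knuthStep : ∀ m {u v} → All (m ≤_) u → KnuthStep u v → erase m u ≈ᴷ erase m v
erase-knuthStep m bound (yzx↦yxz {x} {y} {z} p s x<y y<z)
  rewrite filter-++ (λ x → ¬? (x ≟ m)) p (y ∷ z ∷ x ∷ s) | filter-++ (λ x → ¬? (x ≟ m)) p (y ∷ x ∷ z ∷ s)
  with All.++⁻ʳ p bound
... | _ ∷ _ ∷ m≤x ∷ _ = ≈ᴷ-++ˡ (erase m p) (middle (x ≟ m))
  where
  y≢m : y ≢ m
  y≢m = >⇒≢ (≤-<-trans m≤x x<y)
  z≢m : z ≢ m
  z≢m = >⇒≢ (≤-<-trans m≤x (<-trans x<y y<z))
  middle : Dec (x ≡ m) → erase m (y ∷ z ∷ x ∷ s) ≈ᴷ erase m (y ∷ x ∷ z ∷ s)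
  middle (yes refl)
    rewrite erase-∷-≢ m (z ∷ m ∷ s) y≢m | erase-∷-≢ m (m ∷ s) z≢m | erase-∷-≡ m s
          | erase-∷-≢ m (m ∷ z ∷ s) y≢m | erase-∷-≡ m (z ∷ s) | erase-∷-≢ m s z≢m = ≈ᴷ-refl
  middle (no x≢m)
    rewrite erase-∷-≢ m (z ∷ x ∷ s) y≢m | erase-∷-≢ m (x ∷ s) z≢m | erase-∷-≢ m s x≢m
          | erase-∷-≢ m (x ∷ z ∷ s) y≢m | erase-∷-≢ m (z ∷ s) x≢m | erase-∷-≢ m s z≢m =
    EqClosure.return (yzx↦yxz [] (erase m s) x<y y<z)
erase-knuthStep m bound (xzy↦zxy {x} {y} {z} p s x<y y<z)
  rewrite filter-++ (λ x → ¬? (x ≟ m)) p (x ∷ z ∷ y ∷ s) | filter-++ (λ x → ¬? (x ≟ m)) p (z ∷ x ∷ y ∷ s)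
  with All.++⁻ʳ p bound
... | m≤x ∷ _ ∷ _ ∷ _ = ≈ᴷ-++ˡ (erase m p) (middle (x ≟ m))
  where
  y≢m : y ≢ m
  y≢m = >⇒≢ (≤-<-trans m≤x x<y)
  z≢m : z ≢ m
  z≢m = >⇒≢ (≤-<-trans m≤x (<-trans x<y y<z))
  middle : Dec (x ≡ m) → erase m (x ∷ z ∷ y ∷ s) ≈ᴷ erase m (z ∷ x ∷ y ∷ s)
  middle (yes refl)
    rewrite erase-∷-≡ m (z ∷ y ∷ s) | erase-∷-≢ m (y ∷ s) z≢m | erase-∷-≢ m s y≢m
          | erase-∷-≢ m (m ∷ y ∷ s) z≢m | erase-∷-≡ m (y ∷ s) | erase-∷-≢ m s y≢m = ≈ᴷ-refl
  middle (no x≢m)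
    rewrite erase-∷-≢ m (z ∷ y ∷ s) x≢m | erase-∷-≢ m (y ∷ s) z≢m | erase-∷-≢ m s y≢m
          | erase-∷-≢ m (x ∷ y ∷ s) z≢m | erase-∷-≢ m (y ∷ s) x≢m | erase-∷-≢ m s y≢m =
    EqClosure.return (xzy↦zxy [] (erase m s) x<y y<z)

erase-≈ᴷ : ∀ m {u v} → All (m ≤_) u → u ≈ᴷ v → erase m u ≈ᴷ erase m v
erase-≈ᴷ m bound ε = ≈ᴷ-refl
erase-≈ᴷ m bound (fwd step ◅ steps) =
  ≈ᴷ-trans (erase-knuthStep m bound step) (erase-≈ᴷ m (Perm.All-resp-↭ (knuthStep⇒↭ step) bound) steps)
erase-≈ᴷ m bound (bwd step ◅ steps) with Perm.All-resp-↭ (↭-sym (knuthStep⇒↭ step)) bound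
... | bound′ = ≈ᴷ-trans (≈ᴷ-sym (erase-knuthStep m bound′ step)) (erase-≈ᴷ m bound′ steps)

-- Row insertion and tableaux

Decreasing : List ℕ → Set
Decreasing = AllPairs _>_

data InsertRow (j : ℕ) : List ℕ → Maybe ℕ → List ℕ → Set where
  append : InsertRow j [] nothing (j ∷ [])
  bump : ∀ {x xs} → x < j → InsertRow j (x ∷ xs) (just x) (j ∷ xs)
  pass : ∀ {x xs mb ys} → j ≤ x → InsertRow j xs mb ys → InsertRow j (x ∷ xs) mb (x ∷ ys)

insertRow-spec : ∀ j r → InsertRow j r (proj₁ (insertRow j r)) (proj₂ (insertRow j r))
insertRow-spec j [] = append
insertRow-spec j (x ∷ xs) with x <ᵇ j | <ᵇ-reflects-< x j
... | true | ofʸ x<j = bump x<j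
... | false | ofⁿ x≮j = pass (≮⇒≥ x≮j) (insertRow-spec j xs)

insertRow-spec′ : ∀ {j r mb r′} → insertRow j r ≡ (mb , r′) → InsertRow j r mb r′
insertRow-spec′ {j} {r} eq = subst (λ p → InsertRow j r (proj₁ p) (proj₂ p)) eq (insertRow-spec j r)

module _ {j : ℕ} where

  insertRow-All : ∀ {P : ℕ → Set} {r mb r′} → InsertRow j r mb r′ → All P r → P j → All P r′
  insertRow-All append _ pj = pj ∷ []
  insertRow-All (bump _) (_ ∷ ps) pj = pj ∷ ps
  insertRow-All (pass _ ins) (px ∷ ps) pj = px ∷ insertRow-All ins ps pj

  insertRow-bumped : ∀ {P : ℕ → Set} {r b r′} → InsertRow j r (just b) r′ → All P r → P b
  insertRow-bumped (bump _) (px ∷ _) = px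
  insertRow-bumped (pass _ ins) (_ ∷ ps) = insertRow-bumped ins ps

  insertRow-decreasing : ∀ {r mb r′} → InsertRow j r mb r′ → Decreasing r → All (_≢ j) r → Decreasing r′
  insertRow-decreasing append _ _ = [] ∷ []
  insertRow-decreasing (bump x<j) (x>xs ∷ dec) _ = All-map (λ y<x → <-trans y<x x<j) x>xs ∷ dec
  insertRow-decreasing (pass j≤x ins) (x>xs ∷ dec) (x≢j ∷ ≢j) =
    insertRow-All ins x>xs (≤∧≢ʳ⇒< j≤x x≢j) ∷ insertRow-decreasing ins dec ≢j

  insertRow-nothing : ∀ {r r′} → InsertRow j r nothing r′ → r′ ≡ r ++ j ∷ []
  insertRow-nothing append = refl
  insertRow-nothing (pass _ ins) = cong (_ ∷_) (insertRow-nothing ins)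

  insertRow-head : ∀ {r b r′} → InsertRow j r (just b) r′ → Decreasing r →
    ∃₂ λ w ys → r′ ≡ w ∷ ys × b < w × (∀ {P : ℕ → Set} → P j → All P r → P w)
  insertRow-head (bump x<j) _ = _ , _ , refl , x<j , (λ pj _ → pj)
  insertRow-head (pass _ ins) (x>xs ∷ _) = _ , _ , refl , insertRow-bumped ins x>xs , (λ { _ (px ∷ _) → px })

append-≈ᴷ-bump-head : ∀ {y j} xs → Decreasing (y ∷ xs) → y < j → (y ∷ xs) ++ j ∷ [] ≈ᴷ y ∷ j ∷ xs
append-≈ᴷ-bump-head [] _ _ = ≈ᴷ-refl
append-≈ᴷ-bump-head {y} {j} (x ∷ xs) ((x<y ∷ _) ∷ dec) y<j =
  ≈ᴷ-trans (≈ᴷ-++ˡ (y ∷ []) (append-≈ᴷ-bump-head xs dec (<-trans x<y y<j)))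
           (≈ᴷ-sym (EqClosure.return (yzx↦yxz [] xs x<y y<j)))

insertRow-≈ᴷ : ∀ {j r b r′} → InsertRow j r (just b) r′ → Decreasing r → All (_≢ j) r →
  r ++ j ∷ [] ≈ᴷ b ∷ r′
insertRow-≈ᴷ (bump {x} {xs} x<j) dec _ = append-≈ᴷ-bump-head xs dec x<j
insertRow-≈ᴷ (pass {x} j≤x ins) (x>xs ∷ dec) (x≢j ∷ ≢j) with insertRow-head ins dec
... | w , ys , refl , b<w , head-prop =
  ≈ᴷ-trans (≈ᴷ-++ˡ (x ∷ []) (insertRow-≈ᴷ ins dec ≢j))
           (≈ᴷ-sym (EqClosure.return (xzy↦zxy [] ys b<w (head-prop (≤∧≢ʳ⇒< j≤x x≢j) x>xs))))

-- Prefix _<_ lower upper: the row lower may sit directly under the row upper.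
RowAbove : List ℕ → Tableau → Set
RowAbove r [] = ⊤
RowAbove r (r′ ∷ _) = Prefix _<_ r′ r

data IsTableau : Tableau → Set where
  [] : IsTableau []
  row : ∀ {x xs rs} → Decreasing (x ∷ xs) → RowAbove (x ∷ xs) rs → IsTableau rs → IsTableau ((x ∷ xs) ∷ rs)

readingWord : Tableau → List ℕ
readingWord [] = []
readingWord (r ∷ rs) = readingWord rs ++ r

Prefix-insertRow : ∀ {j U mb U′ L} → InsertRow j U mb U′ → Prefix _<_ L U → Prefix _<_ L U′
Prefix-insertRow _ [] = []
Prefix-insertRow (bump u<j) (l<u ∷ below) = <-trans l<u u<j ∷ below
Prefix-insertRow (pass _ ins) (l<u ∷ below) = l<u ∷ Prefix-insertRow ins below

Prefix-insertRow-bumped : ∀ {y U b U′ L mb L′} → Prefix _<_ L U → Decreasing U →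
  InsertRow y U (just b) U′ → InsertRow b L mb L′ → Prefix _<_ L′ U′
Prefix-insertRow-bumped _ _ (bump u<y) append = u<y ∷ []
Prefix-insertRow-bumped (_ ∷ below) _ (bump u<y) (bump _) = u<y ∷ below
Prefix-insertRow-bumped (l<u ∷ _) _ (bump _) (pass u≤l _) = ⊥-elim (<-irrefl refl (<-≤-trans l<u u≤l))
Prefix-insertRow-bumped _ (u>us ∷ _) (pass _ ins) append = insertRow-bumped ins u>us ∷ []
Prefix-insertRow-bumped (_ ∷ below) (u>us ∷ _) (pass _ ins) (bump _) =
  insertRow-bumped ins u>us ∷ Prefix-insertRow ins below
Prefix-insertRow-bumped (l<u ∷ below) (_ ∷ dec) (pass _ ins) (pass _ ins′) =
  l<u ∷ Prefix-insertRow-bumped below dec ins ins′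

RowAbove-insertRow-bumped : ∀ {j U b U′} rs → RowAbove U rs → Decreasing U →
  InsertRow j U (just b) U′ → RowAbove U′ (rsInsert b rs)
RowAbove-insertRow-bumped [] _ dec ins with insertRow-head ins dec
... | _ , _ , refl , b<w , _ = b<w ∷ []
RowAbove-insertRow-bumped {b = b} (L ∷ rs) below dec ins with insertRow b L in eq
... | nothing , _ = Prefix-insertRow-bumped below dec ins (insertRow-spec′ eq)
... | just _ , _ = Prefix-insertRow-bumped below dec ins (insertRow-spec′ eq)

Unique-∷ʳ⇒∉ : ∀ (xs r : List ℕ) {j} → Unique ((xs ++ r) ++ j ∷ []) → All (_≢ j) r
Unique-∷ʳ⇒∉ xs r u with AllPairs-++⁻ (xs ++ r) u
... | _ , _ , ≢j = All-map (λ { (x≢j ∷ []) → x≢j }) (All.++⁻ʳ xs ≢j)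

Unique-∷ʳ-bumped : ∀ (xs r : List ℕ) {j y r′} → Unique ((xs ++ r) ++ j ∷ []) → InsertRow j r (just y) r′ →
  Unique (xs ++ y ∷ [])
Unique-∷ʳ-bumped xs r u ins with AllPairs-++⁻ (xs ++ r) u
... | uxsr , _ , _ with AllPairs-++⁻ xs uxsr
... | uxs , _ , xs≢r = AllPairs.++⁺ uxs ([] ∷ []) (All-map (λ x≢r → insertRow-bumped ins x≢r ∷ []) xs≢r)

rsInsert-correct : ∀ j T → IsTableau T → Unique (readingWord T ++ j ∷ []) →
  IsTableau (rsInsert j T) × readingWord (rsInsert j T) ≈ᴷ readingWord T ++ j ∷ []
rsInsert-correct j [] [] _ = row ([] ∷ []) tt [] , ≈ᴷ-refl
rsInsert-correct j ((x ∷ xs) ∷ rs) (row dec below tab) u with insertRow j (x ∷ xs) in eq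
... | nothing , r′ with insertRow-spec′ eq
... | ins with insertRow-nothing ins
... | refl = row (insertRow-decreasing ins dec (Unique-∷ʳ⇒∉ (readingWord rs) (x ∷ xs) u)) (below′ rs below) tab ,
             ≈ᴷ-reflexive (sym (++-assoc (readingWord rs) (x ∷ xs) (j ∷ [])))
  where
  below′ : ∀ rs → RowAbove (x ∷ xs) rs → RowAbove (x ∷ xs ++ j ∷ []) rs
  below′ [] _ = tt
  below′ (_ ∷ _) p = Prefix-insertRow ins p
rsInsert-correct j ((x ∷ xs) ∷ rs) (row dec below tab) u | just y , r′ with insertRow-spec′ eq
... | ins with insertRow-head ins dec
... | w , ys , refl , _ , _ with rsInsert-correct y rs tab (Unique-∷ʳ-bumped (readingWord rs) (x ∷ xs) u ins)
... | tab′ , rs′≈ = row (insertRow-decreasing ins dec ∉) (RowAbove-insertRow-bumped rs below dec ins) tab′ , word≈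
  where
  ∉ : All (_≢ j) (x ∷ xs)
  ∉ = Unique-∷ʳ⇒∉ (readingWord rs) (x ∷ xs) u
  word≈ : readingWord (rsInsert y rs) ++ w ∷ ys ≈ᴷ (readingWord rs ++ x ∷ xs) ++ j ∷ []
  word≈ = begin
    readingWord (rsInsert y rs) ++ w ∷ ys ≈⟨ ≈ᴷ-++ʳ (w ∷ ys) rs′≈ ⟩
    (readingWord rs ++ y ∷ []) ++ w ∷ ys  ≡⟨ ++-assoc (readingWord rs) (y ∷ []) (w ∷ ys) ⟩
    readingWord rs ++ y ∷ w ∷ ys          ≈⟨ ≈ᴷ-++ˡ (readingWord rs) (≈ᴷ-sym (insertRow-≈ᴷ ins dec ∉)) ⟩
    readingWord rs ++ (x ∷ xs) ++ j ∷ []  ≡⟨ ++-assoc (readingWord rs) (x ∷ xs) (j ∷ []) ⟨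
    (readingWord rs ++ x ∷ xs) ++ j ∷ []  ∎
    where open ≈ᴷ-Reasoning

readingWord-dropEmpty : ∀ L → readingWord (filterᵇ nonEmpty L) ≡ readingWord L
readingWord-dropEmpty [] = refl
readingWord-dropEmpty ([] ∷ L) = trans (readingWord-dropEmpty L) (sym (++-identityʳ (readingWord L)))
readingWord-dropEmpty ((a ∷ r) ∷ L) = cong (_++ a ∷ r) (readingWord-dropEmpty L)

readingWord-map-erase : ∀ m T → readingWord (map (erase m) T) ≡ erase m (readingWord T)
readingWord-map-erase m [] = refl
readingWord-map-erase m (r ∷ T) =
  trans (cong (_++ erase m r) (readingWord-map-erase m T)) (sym (filter-++ (λ x → ¬? (x ≟ m)) (readingWord T) r))

readingWord-deleteEntry : ∀ m T → readingWord (deleteEntry m T) ≡ erase m (readingWord T)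
readingWord-deleteEntry m T = trans (readingWord-dropEmpty (map (erase m) T)) (readingWord-map-erase m T)

-- The smallest entry m can only be the last entry of a row.
Prefix-erase-min : ∀ {m L U} → Prefix _<_ L U → Decreasing L → All (m ≤_) L → All (m ≤_) U →
  Prefix _<_ (erase m L) (erase m U)
Prefix-erase-min [] _ _ _ = []
Prefix-erase-min {m} (_∷_ {l} {u} {ls} {us} l<u below) (l>ls ∷ dec) (m≤l ∷ m≤ls) (m≤u ∷ m≤us) with l ≟ m
... | yes refl = last ls l>ls m≤ls
  where
  last : ∀ ls → All (l >_) ls → All (l ≤_) ls → Prefix _<_ (erase l (l ∷ ls)) (erase l (u ∷ us))
  last [] _ _ rewrite erase-∷-≡ l [] = []
  last (a ∷ _) (a<l ∷ _) (l≤a ∷ _) = ⊥-elim (<-irrefl refl (<-≤-trans a<l l≤a))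
... | no l≢m rewrite erase-∷-≢ m ls l≢m | erase-∷-≢ m us (>⇒≢ (≤-<-trans m≤l l<u)) =
  l<u ∷ Prefix-erase-min below dec m≤ls m≤us

erase-≡[]⇒≡ : ∀ {m x} xs → erase m (x ∷ xs) ≡ [] → x ≡ m
erase-≡[]⇒≡ {m} {x} xs eq with x ≟ m
... | yes x≡m = x≡m
... | no x≢m with trans (sym (erase-∷-≢ m xs x≢m)) eq
... | ()

IsTableau-dropEmpty-∷ : ∀ r L → Decreasing r → RowAbove r (filterᵇ nonEmpty L) →
  IsTableau (filterᵇ nonEmpty L) → IsTableau (filterᵇ nonEmpty (r ∷ L))
IsTableau-dropEmpty-∷ [] L _ _ tab = tab
IsTableau-dropEmpty-∷ (a ∷ r) L dec above tab = row dec above tab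

RowAbove-dropEmpty-∷ : ∀ {U} r L → Prefix _<_ r U → (r ≡ [] → RowAbove U (filterᵇ nonEmpty L)) →
  RowAbove U (filterᵇ nonEmpty (r ∷ L))
RowAbove-dropEmpty-∷ [] L _ above = above refl
RowAbove-dropEmpty-∷ (a ∷ r) L below _ = below

deleteEntry-tableau : ∀ m T → IsTableau T → All (m ≤_) (readingWord T) → IsTableau (deleteEntry m T)
deleteEntry-tableau m [] [] _ = []
deleteEntry-tableau m ((x ∷ xs) ∷ rs) (row dec below tab) m≤ with All.++⁻ (readingWord rs) m≤
... | m≤rs , m≤r =
  IsTableau-dropEmpty-∷ (erase m (x ∷ xs)) (map (erase m) rs) (AllPairs.filter⁺ (λ x → ¬? (x ≟ m)) dec)
    (above′ rs below tab m≤rs) (deleteEntry-tableau m rs tab m≤rs)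
  where
  above′ : ∀ rs → RowAbove (x ∷ xs) rs → IsTableau rs → All (m ≤_) (readingWord rs) →
    RowAbove (erase m (x ∷ xs)) (deleteEntry m rs)
  above′ [] _ _ _ = tt
  above′ ((y ∷ ys) ∷ rs′) below (row decL belowL tab′) m≤′ with All.++⁻ (readingWord rs′) m≤′
  ... | m≤rs′ , m≤L =
    RowAbove-dropEmpty-∷ (erase m (y ∷ ys)) (map (erase m) rs′) (Prefix-erase-min below decL m≤L m≤r)
      (λ emptied → nothing-under rs′ tab′ belowL m≤rs′ (erase-≡[]⇒≡ ys emptied))
    where
    nothing-under : ∀ rs′ → IsTableau rs′ → RowAbove (y ∷ ys) rs′ → All (m ≤_) (readingWord rs′) → y ≡ m →
      RowAbove (erase m (x ∷ xs)) (deleteEntry m rs′)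
    nothing-under [] _ _ _ _ = tt
    nothing-under ((z ∷ zs) ∷ rr) (row _ _ _) (z<y ∷ _) m≤′′ refl with All.++⁻ʳ (readingWord rr) m≤′′
    ... | m≤z ∷ _ = ⊥-elim (<-irrefl refl (<-≤-trans z<y m≤z))

-- Chains in the reading word of a tableau

increasing-in-decreasing : ∀ {t r} → t ⊆ r → Decreasing r → AllPairs _<_ t → length t ≤ 1
increasing-in-decreasing {[]} _ _ _ = z≤n
increasing-in-decreasing {_ ∷ []} _ _ _ = s≤s z≤n
increasing-in-decreasing {a ∷ b ∷ t} τ dec ((a<b ∷ _) ∷ _) with AllPairs-resp-⊆ τ dec
... | (b<a ∷ _) ∷ _ = ⊥-elim (<-asym a<b b<a)

increasing≤rows : ∀ T → IsTableau T → ∀ {t} → t ⊆ readingWord T → AllPairs _<_ t → length t ≤ length T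
increasing≤rows [] [] [] _ = z≤n
increasing≤rows (r ∷ rs) (row dec _ tab) τ chain with ⊆-++-split (readingWord rs) r τ
... | t₁ , t₂ , refl , τ₁ , τ₂ with AllPairs-++⁻ t₁ chain
... | chain₁ , chain₂ , _ rewrite length-++ t₁ {t₂} =
  subst (_≤ suc (length rs)) (+-comm (length t₂) (length t₁))
    (+-mono-≤ (increasing-in-decreasing τ₂ dec chain₂) (increasing≤rows rs tab τ₁ chain₁))

firstColumn : ∀ x xs rs → IsTableau ((x ∷ xs) ∷ rs) →
  ∃ λ t → t ⊆ readingWord ((x ∷ xs) ∷ rs) × AllPairs _<_ t × length t ≡ suc (length rs) × All (_≤ x) t
firstColumn x xs [] _ = x ∷ [] , refl ∷ minimum xs , [] ∷ [] , refl , ≤-refl ∷ []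
firstColumn x xs ((y ∷ ys) ∷ rs) (row _ (y<x ∷ _) tab) with firstColumn y ys rs tab
... | t , τ , chain , len , ≤y =
  t ++ x ∷ [] , Sublist.++⁺ τ (refl ∷ minimum xs) ,
  AllPairs.++⁺ chain ([] ∷ []) (All-map (λ a≤y → ≤-<-trans a≤y y<x ∷ []) ≤y) ,
  trans (length-++ t) (trans (+-comm (length t) 1) (cong suc len)) ,
  All.++⁺ (All-map (λ a≤y → <⇒≤ (≤-<-trans a≤y y<x)) ≤y) (≤-refl ∷ [])

Prefix-≤-∷ : ∀ {s r u} → Prefix _≤_ s r → Decreasing (u ∷ r) → Prefix _≤_ s (u ∷ r)
Prefix-≤-∷ [] _ = []
Prefix-≤-∷ (x≤r ∷ p) ((u>r ∷ _) ∷ dec) = <⇒≤ (≤-<-trans x≤r u>r) ∷ Prefix-≤-∷ p dec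

⊆-decreasing⇒Prefix-≤ : ∀ {t r} → t ⊆ r → Decreasing r → Prefix _≤_ t r
⊆-decreasing⇒Prefix-≤ [] _ = []
⊆-decreasing⇒Prefix-≤ (_ ∷ʳ τ) dec@(_ ∷ dec′) = Prefix-≤-∷ (⊆-decreasing⇒Prefix-≤ τ dec′) dec
⊆-decreasing⇒Prefix-≤ (refl ∷ τ) (_ ∷ dec) = ≤-refl ∷ ⊆-decreasing⇒Prefix-≤ τ dec

⊆-∷-below⇒⊆ : ∀ {t u r} → t ⊆ u ∷ r → All (_< u) t → t ⊆ r
⊆-∷-below⇒⊆ (_ ∷ʳ τ) _ = τ
⊆-∷-below⇒⊆ (refl ∷ τ) (u<u ∷ _) = ⊥-elim (<-irrefl refl u<u)

Prefix-≤-++ : ∀ {t₂ r} t₁ → Prefix _<_ t₁ r → Decreasing (t₁ ++ t₂) → t₂ ⊆ r → Decreasing r →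
  Prefix _≤_ (t₁ ++ t₂) r
Prefix-≤-++ [] [] _ τ dec = ⊆-decreasing⇒Prefix-≤ τ dec
Prefix-≤-++ (a ∷ t₁) (a<u ∷ below) (a>t ∷ chain) τ (_ ∷ dec) =
  <⇒≤ a<u ∷ Prefix-≤-++ t₁ below chain
    (⊆-∷-below⇒⊆ τ (All-map (λ b<a → <-trans b<a a<u) (All.++⁻ʳ t₁ a>t))) dec

decreasing≤firstRow : ∀ r rs → IsTableau (r ∷ rs) → ∀ {t} → t ⊆ readingWord (r ∷ rs) → Decreasing t →
  Prefix _≤_ t r
decreasing≤firstRow r [] (row dec _ _) τ _ = ⊆-decreasing⇒Prefix-≤ τ dec
decreasing≤firstRow r (r′ ∷ rs) (row dec below tab@(row _ _ _)) τ chain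
  with ⊆-++-split (readingWord (r′ ∷ rs)) r τ
... | t₁ , t₂ , refl , τ₁ , τ₂ =
  Prefix-≤-++ t₁ (Prefix.trans ≤-<-trans (decreasing≤firstRow r′ rs tab τ₁ (proj₁ (AllPairs-++⁻ t₁ chain))) below)
    chain τ₂ dec

hasChain<⇔rows : ∀ {k} T → IsTableau T → HasChain _<_ k (readingWord T) ⇔ k ≤ length T
hasChain<⇔rows T tab = mk⇔ (λ (_ , τ , chain , k≤) → ≤-trans k≤ (increasing≤rows T tab τ chain)) (from T tab)
  where
  from : ∀ {k} T → IsTableau T → k ≤ length T → HasChain _<_ k (readingWord T)
  from [] _ k≤ = [] , [] , [] , k≤
  from ((x ∷ xs) ∷ rs) tab k≤ with firstColumn x xs rs tab
  ... | t , τ , chain , len , _ = t , τ , chain , subst (_ ≤_) (sym len) k≤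

hasChain>⇔cols : ∀ {k} T → IsTableau T → HasChain _>_ k (readingWord T) ⇔ k ≤ numCols (shape T)
hasChain>⇔cols T tab = mk⇔ (to T tab) (from T tab)
  where
  to : ∀ {k} T → IsTableau T → HasChain _>_ k (readingWord T) → k ≤ numCols (shape T)
  to [] _ (_ , [] , _ , k≤) = k≤
  to (r ∷ rs) tab (_ , τ , chain , k≤) = ≤-trans k≤ (Prefix.length-mono (decreasing≤firstRow r rs tab τ chain))
  from : ∀ {k} T → IsTableau T → k ≤ numCols (shape T) → HasChain _>_ k (readingWord T)
  from [] _ k≤ = [] , [] , [] , k≤
  from (r ∷ rs) (row dec _ _) k≤ = r , Sublist.++⁺ (minimum (readingWord rs)) ⊆-refl , dec , k≤

-- Arcs of a set partition

firstOf-filterᵇ-sound : ∀ (Q : ℕ → Bool) xs {b} → AllPairs _<_ xs → firstOf (filterᵇ Q xs) ≡ just b →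
  b ∈ xs × T (Q b) × (∀ {c} → c ∈ xs → c < b → ¬ T (Q c))
firstOf-filterᵇ-sound Q (x ∷ xs) (x<xs ∷ sorted) eq with Q x in qx
firstOf-filterᵇ-sound Q (x ∷ xs) (x<xs ∷ sorted) refl | true = here refl , subst T (sym qx) tt , minimal
  where
  minimal : ∀ {c} → c ∈ x ∷ xs → c < x → ¬ T (Q c)
  minimal (here refl) c<x = ⊥-elim (<-irrefl refl c<x)
  minimal (there c∈) c<x = ⊥-elim (<-asym c<x (All-lookup x<xs c∈))
... | false with firstOf-filterᵇ-sound Q xs sorted eq
... | b∈ , qb , minimal = there b∈ , qb , minimal′
  where
  minimal′ : ∀ {c} → c ∈ x ∷ xs → c < _ → ¬ T (Q c)
  minimal′ (here refl) _ = subst T qx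
  minimal′ (there c∈) = minimal c∈

firstOf-filterᵇ-complete : ∀ (Q : ℕ → Bool) xs {b} → AllPairs _<_ xs → b ∈ xs → T (Q b) →
  (∀ {c} → c ∈ xs → c < b → ¬ T (Q c)) → firstOf (filterᵇ Q xs) ≡ just b
firstOf-filterᵇ-complete Q (x ∷ xs) sorted b∈ qb minimal with Q x in qx
firstOf-filterᵇ-complete Q (x ∷ xs) _ (here refl) _ _ | true = refl
firstOf-filterᵇ-complete Q (x ∷ xs) (x<xs ∷ _) (there b∈) _ minimal | true =
  ⊥-elim (minimal (here refl) (All-lookup x<xs b∈) (subst T (sym qx) tt))
firstOf-filterᵇ-complete Q (x ∷ xs) _ (here refl) qb _ | false = ⊥-elim (subst T qx qb)
firstOf-filterᵇ-complete Q (x ∷ xs) (_ ∷ sorted) (there b∈) qb minimal | false =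
  firstOf-filterᵇ-complete Q xs sorted b∈ qb (minimal ∘ there)

module Arcs {n : ℕ} (π : SetPartition n) where

  above-sorted : ∀ a → AllPairs _<_ (above n a)
  above-sorted a = AllPairs.filter⁺ (T? ∘ (a <ᵇ_)) (AllPairs.applyUpTo⁺₁ id (suc n) (λ i<j _ → i<j))

  ∈-above⁻ : ∀ {a c} → c ∈ above n a → c ≤ n × a < c
  ∈-above⁻ {a} c∈ with ∈-filter⁻ (T? ∘ (a <ᵇ_)) c∈
  ... | c∈upTo , a<ᵇc = ≤-pred (∈-upTo⁻ c∈upTo) , <ᵇ⇒< a _ a<ᵇc

  ∈-above⁺ : ∀ {a c} → c ≤ n → a < c → c ∈ above n a
  ∈-above⁺ c≤n a<c = ∈-filter⁺ (T? ∘ (_ <ᵇ_)) (∈-upTo⁺ (s≤s c≤n)) (<⇒<ᵇ a<c)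

  sameBlockᵇ : ℕ → ℕ → Bool
  sameBlockᵇ a j = block π j ≡ᵇ block π a

  arcFrom-sound : ∀ {a b} → 1 ≤ a → arcFrom π a ≡ just b → Arc π a b
  arcFrom-sound {a} {b} 1≤a eq with firstOf-filterᵇ-sound (sameBlockᵇ a) (above n a) (above-sorted a) eq
  ... | b∈ , same , minimal with ∈-above⁻ b∈
  ... | b≤n , a<b = 1≤a , a<b , b≤n , sym (≡ᵇ⇒≡ _ _ same) , other-blocks
    where
    other-blocks : ∀ c → a < c → c < b → block π c ≢ block π a
    other-blocks c a<c c<b same-c = minimal (∈-above⁺ (≤-trans (<⇒≤ c<b) b≤n) a<c) c<b (≡⇒≡ᵇ _ _ same-c)

  arcFrom-complete : ∀ {a b} → Arc π a b → arcFrom π a ≡ just b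
  arcFrom-complete {a} (_ , a<b , b≤n , same , other-blocks) =
    firstOf-filterᵇ-complete (sameBlockᵇ a) (above n a) (above-sorted a) (∈-above⁺ b≤n a<b)
      (≡⇒≡ᵇ _ _ (sym same)) (λ c∈ c<b → other-blocks _ (proj₂ (∈-above⁻ c∈)) c<b ∘ ≡ᵇ⇒≡ _ _)

  Arc⇒isRightEnd : ∀ {a b} → Arc π a b → T (isRightEnd π b)
  Arc⇒isRightEnd {suc a} {b} (_ , a<b , _ , same , _) = Any.any⁺ _ (lose (∈-upTo⁺ a<b) (≡⇒≡ᵇ _ _ same))

  Open : ℕ → ℕ × ℕ → Set
  Open i (a , b) = Arc π a b × a ≤ i × i < b

  closeAt : Bool → ℕ → List (ℕ × ℕ) → List (ℕ × ℕ)
  closeAt true m L = filter (λ p → ¬? (proj₂ p ≟ m)) L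
  closeAt false m L = L

  openAt : ℕ → Maybe ℕ → List (ℕ × ℕ)
  openAt a nothing = []
  openAt a (just b) = (a , b) ∷ []

  -- The arcs open at i, by increasing left endpoint, built in step with the tableaux T_{2i}.
  openArcs : ℕ → List (ℕ × ℕ)
  openArcs zero = []
  openArcs (suc i) = closeAt (isRightEnd π (suc i)) (suc i) (openArcs i) ++ openAt (suc i) (arcFrom π (suc i))

  SortedByLeft : List (ℕ × ℕ) → Set
  SortedByLeft = AllPairs (_<_ on proj₁)

  closeAt-sorted : ∀ bo m {L} → SortedByLeft L → SortedByLeft (closeAt bo m L)
  closeAt-sorted true m sorted = AllPairs.filter⁺ _ sorted
  closeAt-sorted false m sorted = sorted

  closeAt-All : ∀ {P : ℕ × ℕ → Set} bo m {L} → All P L → All P (closeAt bo m L)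
  closeAt-All true m ps = All.filter⁺ _ ps
  closeAt-All false m ps = ps

  closeAt-open : ∀ i {L} → All (Open i) L → All (Open (suc i)) (closeAt (isRightEnd π (suc i)) (suc i) L)
  closeAt-open i {L} live with isRightEnd π (suc i) in isEnd
  ... | true = All-zipWith (λ ((arc , a≤i , i<b) , b≢) → arc , m≤n⇒m≤1+n a≤i , ≤∧≢ʳ⇒< i<b b≢)
                 (All.filter⁺ (λ p → ¬? (proj₂ p ≟ suc i)) live , All.all-filter (λ p → ¬? (proj₂ p ≟ suc i)) L)
  ... | false = All-map (λ (arc , a≤i , i<b) → arc , m≤n⇒m≤1+n a≤i , ≤∧≢ʳ⇒< i<b (not-closing arc)) live
    where
    not-closing : ∀ {a b} → Arc π a b → b ≢ suc i
    not-closing arc refl = subst T isEnd (Arc⇒isRightEnd arc)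

  openAt-open : ∀ i → All (Open (suc i)) (openAt (suc i) (arcFrom π (suc i)))
  openAt-open i with arcFrom π (suc i) in starts
  ... | nothing = []
  ... | just b with arcFrom-sound (s≤s z≤n) starts
  ...   | arc@(_ , i<b , _) = (arc , ≤-refl , i<b) ∷ []

  openAt-after : ∀ a mb {L : List (ℕ × ℕ)} → All (λ p → proj₁ p < a) L →
    All (λ p → All (λ q → proj₁ p < proj₁ q) (openAt a mb)) L
  openAt-after a nothing ps = All-map (λ _ → []) ps
  openAt-after a (just b) ps = All-map (_∷ []) ps

  openArcs-sorted∧open : ∀ i → SortedByLeft (openArcs i) × All (Open i) (openArcs i)
  openArcs-sorted∧open zero = [] , []
  openArcs-sorted∧open (suc i) with openArcs-sorted∧open i
  ... | sorted , live =
    AllPairs.++⁺ (closeAt-sorted bo (suc i) sorted) (openAt-sorted (arcFrom π (suc i)))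
      (openAt-after (suc i) (arcFrom π (suc i)) (closeAt-All bo (suc i) (All-map (λ (_ , a≤i , _) → s≤s a≤i) live))) ,
    All.++⁺ (closeAt-open i live) (openAt-open i)
    where
    bo : Bool
    bo = isRightEnd π (suc i)
    openAt-sorted : ∀ mb → SortedByLeft (openAt (suc i) mb)
    openAt-sorted nothing = []
    openAt-sorted (just _) = [] ∷ []

  openArcs-complete : ∀ i {p} → Open i p → p ∈ openArcs i
  openArcs-complete zero ((() , _) , z≤n , _)
  openArcs-complete (suc i) {a , b} (arc , a≤1+i , 1+i<b) with a ≟ suc i
  ... | yes refl rewrite arcFrom-complete arc = ∈-++⁺ʳ (closeAt (isRightEnd π (suc i)) (suc i) (openArcs i)) (here refl)
  ... | no a≢1+i = ∈-++⁺ˡ (kept (isRightEnd π (suc i)))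
    where
    earlier : (a , b) ∈ openArcs i
    earlier = openArcs-complete i (arc , ≤-pred (≤∧≢⇒< a≤1+i a≢1+i) , <-trans (s≤s ≤-refl) 1+i<b)
    kept : ∀ bo → (a , b) ∈ closeAt bo (suc i) (openArcs i)
    kept true = ∈-filter⁺ (λ p → ¬? (proj₂ p ≟ suc i)) earlier (λ b≡1+i → <-irrefl (sym b≡1+i) 1+i<b)
    kept false = earlier

  rightEnds : List (ℕ × ℕ) → List ℕ
  rightEnds = map proj₂

  rightEnds-unique : ∀ i → Unique (rightEnds (openArcs i))
  rightEnds-unique i with openArcs-sorted∧open i
  ... | sorted , live = AllPairs.map⁺ (AllPairs-mapWithAll distinct live sorted)
    where
    distinct : ∀ {p q} → Open i p → Open i q → proj₁ p < proj₁ q → proj₂ p ≢ proj₂ q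
    distinct ((_ , _ , _ , same , other-blocks) , _) ((_ , a′<b′ , _ , same′ , _) , _) a<a′ refl =
      other-blocks _ a<a′ a′<b′ (trans same′ (sym same))

  rightEnds-beyond : ∀ i → All (suc i ≤_) (rightEnds (openArcs i))
  rightEnds-beyond i = All.map⁺ (All-map (λ (_ , _ , i<b) → i<b) (proj₂ (openArcs-sorted∧open i)))

  erase-rightEnds : ∀ m L → erase m (rightEnds L) ≡ rightEnds (closeAt true m L)
  erase-rightEnds m [] = refl
  erase-rightEnds m ((a , b) ∷ L) with b ≟ m
  ... | yes refl = trans (erase-∷-≡ m (rightEnds L)) (trans (erase-rightEnds m L)
                   (cong rightEnds (sym (filter-reject (λ p → ¬? (proj₂ p ≟ m)) (λ m≢m → m≢m refl)))))
  ... | no b≢m = trans (erase-∷-≢ m (rightEnds L) b≢m) (trans (cong (b ∷_) (erase-rightEnds m L))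
                  (cong rightEnds (sym (filter-accept (λ p → ¬? (proj₂ p ≟ m)) b≢m))))

  invariant-delete : ∀ {i T} → IsTableau T → readingWord T ≈ᴷ rightEnds (openArcs i) →
    IsTableau (stepDelete π (suc i) T) ×
    readingWord (stepDelete π (suc i) T) ≈ᴷ rightEnds (closeAt (isRightEnd π (suc i)) (suc i) (openArcs i))
  invariant-delete {i} {T} tab word≈ with isRightEnd π (suc i)
  ... | true = deleteEntry-tableau (suc i) T tab beyond , word≈′
    where
    beyond : All (suc i ≤_) (readingWord T)
    beyond = Perm.All-resp-↭ (↭-sym (≈ᴷ⇒↭ word≈)) (rightEnds-beyond i)
    word≈′ : readingWord (deleteEntry (suc i) T) ≈ᴷ rightEnds (closeAt true (suc i) (openArcs i))
    word≈′ = begin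
      readingWord (deleteEntry (suc i) T)            ≡⟨ readingWord-deleteEntry (suc i) T ⟩
      erase (suc i) (readingWord T)                  ≈⟨ erase-≈ᴷ (suc i) beyond word≈ ⟩
      erase (suc i) (rightEnds (openArcs i))         ≡⟨ erase-rightEnds (suc i) (openArcs i) ⟩
      rightEnds (closeAt true (suc i) (openArcs i))  ∎
      where open ≈ᴷ-Reasoning
  ... | false = tab , word≈

  invariant-insert : ∀ a L {T} → IsTableau T → readingWord T ≈ᴷ rightEnds L →
    Unique (rightEnds (L ++ openAt a (arcFrom π a))) →
    IsTableau (stepInsert π a T) × readingWord (stepInsert π a T) ≈ᴷ rightEnds (L ++ openAt a (arcFrom π a))
  invariant-insert a L {T} tab word≈ unique with arcFrom π a
  ... | nothing = tab , ≈ᴷ-trans word≈ (≈ᴷ-reflexive (cong rightEnds (sym (++-identityʳ L))))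
  ... | just b with rsInsert-correct b T tab (Unique-resp-↭ (↭⇒↭ₛ (↭-sym appended↭)) unique′)
    where
    appended↭ : readingWord T ++ b ∷ [] ↭ rightEnds L ++ b ∷ []
    appended↭ = Perm.++⁺ʳ (b ∷ []) (≈ᴷ⇒↭ word≈)
    unique′ : Unique (rightEnds L ++ b ∷ [])
    unique′ = subst Unique (map-++ proj₂ L ((a , b) ∷ [])) unique
  ... | tab′ , word′≈ = tab′ , ≈ᴷ-trans word′≈
          (≈ᴷ-trans (≈ᴷ-++ʳ (b ∷ []) word≈) (≈ᴷ-reflexive (sym (map-++ proj₂ L ((a , b) ∷ [])))))

  invariant : ∀ i → IsTableau (tabEven π i) × readingWord (tabEven π i) ≈ᴷ rightEnds (openArcs i)
  invariant zero = [] , ≈ᴷ-refl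
  invariant (suc i) with invariant i
  ... | tab , word≈ with invariant-delete tab word≈
  ... | tab′ , word′≈ =
    invariant-insert (suc i) (closeAt (isRightEnd π (suc i)) (suc i) (openArcs i)) tab′ word′≈ (rightEnds-unique (suc i))

  -- BelowCrossing π i k and BelowNesting π i k are, definitionally, BelowChains _<_ i k and BelowChains _>_ i k.
  BelowChains : (ℕ → ℕ → Set) → ℕ → ℕ → Set
  BelowChains S i k = Σ (Fin k → ℕ) λ I → Σ (Fin k → ℕ) λ J →
    (∀ a → Arc π (I a) (J a)) × (∀ a → I a ≤ i × suc i ≤ J a) ×
    (∀ a b → a <ᶠ b → I a < I b × S (J a) (J b))

  belowChains⇔hasChain : ∀ S i k → BelowChains S i k ⇔ HasChain S k (rightEnds (openArcs i))
  belowChains⇔hasChain S i k = mk⇔ to from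
    where
    to : BelowChains S i k → HasChain S k (rightEnds (openArcs i))
    to (I , J , arc , bounds , mono) =
      rightEnds L , Sublist.map⁺ proj₂ (sorted-⊆ proj₁ (proj₁ (openArcs-sorted∧open i)) sorted-L L⊆) ,
      AllPairs.map⁺ (AllPairs.tabulate⁺-< (λ a<b → proj₂ (mono _ _ a<b))) ,
      subst (k ≤_) (sym (trans (length-map proj₂ L) (length-tabulate _))) ≤-refl
      where
      L : List (ℕ × ℕ)
      L = tabulate (λ a → I a , J a)
      sorted-L : SortedByLeft L
      sorted-L = AllPairs.tabulate⁺-< (λ a<b → proj₁ (mono _ _ a<b))
      L⊆ : All (_∈ openArcs i) L
      L⊆ = All.tabulate⁺ (λ a → openArcs-complete i (arc a , bounds a))
    from : HasChain S k (rightEnds (openArcs i)) → BelowChains S i k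
    from (t , τ , chain , k≤) with ⊆-map-preimage proj₂ (openArcs i) τ
    ... | L , σ , refl = proj₁ ∘ arcAt , proj₂ ∘ arcAt , proj₁ ∘ live , proj₂ ∘ live , mono
      where
      k≤L : k ≤ length L
      k≤L = subst (k ≤_) (length-map proj₂ L) k≤
      index : Fin k → Fin (length L)
      index a = inject≤ a k≤L
      arcAt : Fin k → ℕ × ℕ
      arcAt a = lookup L (index a)
      live : ∀ a → Open i (arcAt a)
      live a = All-lookup (All-resp-⊆ σ (proj₂ (openArcs-sorted∧open i))) (∈-lookup (index a))
      mono : ∀ a b → a <ᶠ b → proj₁ (arcAt a) < proj₁ (arcAt b) × S (proj₂ (arcAt a)) (proj₂ (arcAt b))
      mono a b a<b = AllPairs-lookup (AllPairs-resp-⊆ σ (proj₁ (openArcs-sorted∧open i))) index<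
                   , AllPairs-lookup (AllPairs.map⁻ chain) index<
        where
        index< : index a <ᶠ index b
        index< = subst₂ _<_ (sym (toℕ-inject≤ a k≤L)) (sym (toℕ-inject≤ b k≤L)) a<b

tab-even : ∀ {n} (π : SetPartition n) i → tab π (2 * i) ≡ tabEven π i
tab-even π i = trans (tab-of-even (2 * i) (trans (cong (_% 2) (*-comm 2 i)) (m*n%n≡0 i 2)))
                     (cong (tabEven π) (trans (cong (_/ 2) (*-comm 2 i)) (m*n/n≡m i 2)))
  where
  tab-of-even : ∀ r → r % 2 ≡ 0 → tab π r ≡ tabEven π (r / 2)
  tab-of-even r even with r % 2
  ... | zero = refl
  tab-of-even r () | suc _

proposition3 : (n : ℕ) (π : SetPartition n) (i : ℕ) → 1 ≤ i → i ≤ n →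
    (k : ℕ) → 1 ≤ k →
    (BelowCrossing π i k ⇔ k ≤ numRows (phi π (2 * i))) ×
    (BelowNesting π i k ⇔ k ≤ numCols (phi π (2 * i)))
proposition3 n π i _ _ k _ = crossings , nestings
  where
  open Arcs π
  open EqReasoning (⇔-setoid 0ℓ)
  T₂ᵢ : Tableau
  T₂ᵢ = tabEven π i
  shape≡ : phi π (2 * i) ≡ shape T₂ᵢ
  shape≡ = cong shape (tab-even π i)
  crossings : BelowCrossing π i k ⇔ k ≤ numRows (phi π (2 * i))
  crossings = begin
    BelowCrossing π i k                       ≈⟨ belowChains⇔hasChain _<_ i k ⟩
    HasChain _<_ k (rightEnds (openArcs i))   ≈⟨ ≈ᴷ-hasChain< (≈ᴷ-sym (proj₂ (invariant i))) ⟩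
    HasChain _<_ k (readingWord T₂ᵢ)          ≈⟨ hasChain<⇔rows T₂ᵢ (proj₁ (invariant i)) ⟩
    k ≤ length T₂ᵢ                            ≡⟨ cong (k ≤_) (sym (length-map length T₂ᵢ)) ⟩
    k ≤ numRows (shape T₂ᵢ)                   ≡⟨ cong (λ s → k ≤ numRows s) shape≡ ⟨
    k ≤ numRows (phi π (2 * i))               ∎
  nestings : BelowNesting π i k ⇔ k ≤ numCols (phi π (2 * i))
  nestings = begin
    BelowNesting π i k                        ≈⟨ belowChains⇔hasChain _>_ i k ⟩
    HasChain _>_ k (rightEnds (openArcs i))   ≈⟨ ≈ᴷ-hasChain> (≈ᴷ-sym (proj₂ (invariant i))) ⟩
    HasChain _>_ k (readingWord T₂ᵢ)          ≈⟨ hasChain>⇔cols T₂ᵢ (proj₁ (invariant i)) ⟩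
    k ≤ numCols (shape T₂ᵢ)                   ≡⟨ cong (λ s → k ≤ numCols s) shape≡ ⟨
    k ≤ numCols (phi π (2 * i))               ∎
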